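{- For every $m\ge0$, the classes $\mathrm{p\text{ - }FD}(E_1^{=}e^ma)$, $\mathrm{p\text{ - }FD}(E_1^{\le}e^ma)$ and $\mathrm{p\text{ - }FD}(E_1^{\ge}e^ma)$ are subsets of $\mathrm{para\text{ - }AC}^0$.
   Context: Vocabularies contain only relation symbols; structures are finite. For $\bowtie\in\{=,\le,\ge\}$ and $p\in\{a,e\}^*$, a formula with pattern $E_1^{\bowtie}p$ is $\exists^{\bowtie}X\,\varphi(X)$, $X$ a unary second-order variable, $\varphi(X)$ first-order (with equality) in prenex form with quantifier prefix $p$ ($a$ = $\forall$, $e$ = $\exists$); $(\mathcal S,k)\models\exists^{\bowtie}X\,\varphi(X)$ iff there is $C\subseteq U$ (universe of $\mathcal S$) with $|C|\bowtie k$ and $\mathcal S\models\varphi(C)$. $\mathrm{p\text{ - }FD}(E_1^{\bowtie}p)$ is the class of all parameterized problems $\{(\mathcal S,k)\mid(\mathcal S,k)\models\psi\}$ (parameter $k$) for $\psi$ of that pattern over any vocabulary. $\mathrm{para\text{ - }AC}^0$: parameterized problems decided by constant-depth unbounded fan-in circuit families of size $f(k)n^{O(1)}$, $f$ computable. -}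

module Defs where

open import Data.Nat using (ℕ; zero; suc; _+_; _*_; _^_; _≤_; _≥_; _⊔_)
open import Data.Fin using (Fin)
open import Data.Vec using (Vec; []; _∷_; _∷ʳ_; lookup; map; last)
open import Data.List as List using (List; []; _∷_; replicate; _++_; foldr)
open import Data.Bool.ListAction using (and; or)
open import Data.Bool using (Bool; true; false; not)
open import Data.Product using (Σ; _×_; _,_; proj₁; proj₂)
open import Data.Empty using (⊥)
open import Relation.Nullary using (¬_)
open import Relation.Binary.PropositionalEquality using (_≡_)
open import Data.Fin.Subset using (Subset; _∈_; ∣_∣)
open import Function.Bundles using (_⇔_)

record Vocabulary : Set where
  field
    nrel  : ℕ
    arity : Fin nrel → ℕ
open Vocabulary public

record Structure (τ : Vocabulary) : Set where
  field
    size : ℕ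
    rel  : (r : Fin (nrel τ)) → Vec (Fin size) (arity τ r) → Bool
open Structure public

-- First-order formulas (with equality) with one free unary
-- second-order variable X; first-order variables are de Bruijn
-- indices in Fin v.

data QF (τ : Vocabulary) (v : ℕ) : Set where
  atom  : (r : Fin (nrel τ)) → Vec (Fin v) (arity τ r) → QF τ v
  equal : Fin v → Fin v → QF τ v
  inX   : Fin v → QF τ v
  neg   : QF τ v → QF τ v
  conj  : QF τ v → QF τ v → QF τ v
  disj  : QF τ v → QF τ v → QF τ v

⟦_⟧qf : ∀ {τ v} → QF τ v → (S : Structure τ) → Subset (size S)
        → Vec (Fin (size S)) v → Set
⟦ atom r xs ⟧qf S C ρ = rel S r (map (lookup ρ) xs) ≡ true
⟦ equal x y ⟧qf S C ρ = lookup ρ x ≡ lookup ρ y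
⟦ inX x ⟧qf S C ρ = lookup ρ x ∈ C
⟦ neg φ ⟧qf S C ρ = ¬ (⟦ φ ⟧qf S C ρ)
⟦ conj φ ψ ⟧qf S C ρ = ⟦ φ ⟧qf S C ρ × ⟦ ψ ⟧qf S C ρ
⟦ disj φ ψ ⟧qf S C ρ = Data.Sum._⊎_ (⟦ φ ⟧qf S C ρ) (⟦ ψ ⟧qf S C ρ)
  where import Data.Sum

-- quantifier letters: a = ∀, e = ∃
data Quant : Set where
  a e : Quant

-- prenex formulas with quantifier prefix p (outermost first) and
-- v free first-order variables
data Prenex (τ : Vocabulary) : List Quant → ℕ → Set where
  matrix : ∀ {v} → QF τ v → Prenex τ [] v
  ∀'     : ∀ {p v} → Prenex τ p (suc v) → Prenex τ (a ∷ p) v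
  ∃'     : ∀ {p v} → Prenex τ p (suc v) → Prenex τ (e ∷ p) v

⟦_⟧pr : ∀ {τ p v} → Prenex τ p v → (S : Structure τ) → Subset (size S)
        → Vec (Fin (size S)) v → Set
⟦ matrix φ ⟧pr S C ρ = ⟦ φ ⟧qf S C ρ
⟦ ∀' φ ⟧pr S C ρ = (x : Fin (size S)) → ⟦ φ ⟧pr S C (x ∷ ρ)
⟦ ∃' φ ⟧pr S C ρ = Σ (Fin (size S)) λ x → ⟦ φ ⟧pr S C (x ∷ ρ)

data Cmp : Set where
  EQ LE GE : Cmp

cmp : Cmp → ℕ → ℕ → Set
cmp EQ m n = m ≡ n
cmp LE m n = m ≤ n
cmp GE m n = m ≥ n

_,_⊨∃X[_]_ : ∀ {τ p} → Structure τ → ℕ → Cmp → Prenex τ p 0 → Set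
S , k ⊨∃X[ ⋈ ] φ = Σ (Subset (size S)) λ C → cmp ⋈ ∣ C ∣ k × ⟦ φ ⟧pr S C []

ParProblem : Vocabulary → Set₁
ParProblem τ = Structure τ → ℕ → Set

InPFD : Cmp → List Quant → (τ : Vocabulary) → ParProblem τ → Set
InPFD ⋈ p τ Q = Σ (Prenex τ p 0) λ φ →
  (S : Structure τ) (k : ℕ) → Q S k ⇔ (S , k ⊨∃X[ ⋈ ] φ)

eᵐa : ℕ → List Quant
eᵐa m = replicate m e ++ (a ∷ [])

-- Boolean circuits (DAGs) with unbounded fan-in, over input bits I.
-- A gate numbered j may only read gates with smaller numbers (Fin j).

data Gate (I : Set) (j : ℕ) : Set where
  input : I → Gate I j
  NOT   : Fin j → Gate I j
  AND   : List (Fin j) → Gate I j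
  OR    : List (Fin j) → Gate I j

data Circuit (I : Set) : ℕ → Set where
  []  : Circuit I 0
  _▷_ : ∀ {j} → Circuit I j → Gate I j → Circuit I (suc j)

gateVal : ∀ {I j} → Gate I j → (I → Bool) → Vec Bool j → Bool
gateVal (input i) x vs = x i
gateVal (NOT g)   x vs = not (lookup vs g)
gateVal (AND gs)  x vs = and (List.map (lookup vs) gs)
gateVal (OR gs)   x vs = or (List.map (lookup vs) gs)

values : ∀ {I s} → Circuit I s → (I → Bool) → Vec Bool s
values [] x = []
values (c ▷ g) x = let vs = values c x in vs ∷ʳ gateVal g x vs

gateDepth : ∀ {I j} → Gate I j → Vec ℕ j → ℕ
gateDepth (input i) ds = 0
gateDepth (NOT g)   ds = suc (lookup ds g)
gateDepth (AND gs)  ds = suc (foldr _⊔_ 0 (List.map (lookup ds) gs))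
gateDepth (OR gs)   ds = suc (foldr _⊔_ 0 (List.map (lookup ds) gs))

depths : ∀ {I s} → Circuit I s → Vec ℕ s
depths [] = []
depths (c ▷ g) = let ds = depths c in ds ∷ʳ gateDepth g ds

depth : ∀ {I s} → Circuit I s → ℕ
depth c = Data.Vec.foldr _ _⊔_ 0 (depths c)
  where import Data.Vec

output : ∀ {I s} → Circuit I (suc s) → (I → Bool) → Bool
output c x = last (values c x)

-- Encoding a structure as input bits: one bit per relation symbol r
-- and tuple t ∈ U^{ar(r)}, telling whether r(t) holds.

InputBits : Vocabulary → ℕ → Set
InputBits τ n = Σ (Fin (nrel τ)) λ r → Vec (Fin n) (arity τ r)

encode : ∀ {τ} (S : Structure τ) → InputBits τ (size S) → Bool
encode S (r , t) = rel S r t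

-- para-AC⁰: decided by a (non-uniform) family of circuits C_{n,k}
-- (n = universe size, k = parameter) of constant depth d and size
-- at most f(k)·(n+1)^c, with f an (Agda-definable, hence computable)
-- function.
InParaAC0 : (τ : Vocabulary) → ParProblem τ → Set
InParaAC0 τ Q =
  Σ (ℕ → ℕ) λ f → Σ ℕ λ c → Σ ℕ λ d →
  Σ ((n k : ℕ) → Σ ℕ λ s → Circuit (InputBits τ n) (suc s)) λ C →
    ((n k : ℕ) → (suc (proj₁ (C n k)) ≤ f k * (suc n) ^ c)
                 × depth (proj₂ (C n k)) ≤ d)
    × ((S : Structure τ) (k : ℕ) →
         Q S k ⇔ (output (proj₂ (C (size S) k)) (encode S) ≡ true))

-- Fix a sentence ∃^⋈ X ∃y₁ … ∃yₘ ∀z ψ(X, y, z) and a structure with n elements. Once the yᵢ and the bits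
-- β = (X(y₁), …, X(yₘ)) are guessed, ψ constrains X only pointwise: X(z) = b is allowed when it agrees with
-- β and makes ψ(z) true. A witness C with |C| ⋈ k therefore exists iff every z has an allowed value and the
-- forced set F = {z | X(z) = false is not allowed} and the possible set P = {z | X(z) = true is allowed}
-- satisfy |F| ≤ k and/or k ≤ |P| according to ⋈, since every size between |F| and |P| is attained by a set
-- between them. The nᵐ 2ᵐ guesses are polynomially many disjuncts, and "at least k of n bits are true" has a
-- formula of constant depth and size f(k)·n²: k distinct indices, written with L ≈ log n binary digits, are
-- already told apart by k − 1 digit positions, so one guesses those positions (L^(k−1) ≤ f(k)·n choices) and
-- k distinct patterns on them, each shown by some true bit. A formula compiles into a circuit of the same size
-- and depth.

module Submission where

open import Defs hiding (a; e)
open import Data.Nat using (ℕ; zero; suc; _+_; _*_; _^_; _≤_; _<_; _⊔_; z≤n; s≤s; _≤?_)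
open import Data.Nat.Properties hiding (suc-injective; 0≢1+n)
open import Data.Nat.DivMod using (_/_; _%_; m≡m%n+[m/n]*n; m%n<n; m/n*n≤m)
open import Data.Nat.Tactic.RingSolver using (solve-∀)
open import Data.Fin using (Fin; zero; suc; inject₁; inject≤; fromℕ; finToFun; funToFin; combine)
  renaming (_≟_ to _≟ᶠ_)
open import Data.Fin.Properties
  using (injective⇒≤; inject≤-injective; suc-injective; 0≢1+n; any?; all?; ¬∀⟶∃¬; funToFin-finToFin)
open import Data.Fin.Subset using (Subset; _∈_; _⊆_; ∣_∣)
open import Data.Fin.Subset.Properties using (drop-∷-⊆; in⊆in; out⊆; ⊆-refl; ⊆-trans; p⊆q⇒∣p∣≤∣q∣)
open import Data.Vec using (Vec; []; _∷_; _∷ʳ_; lookup; last; tabulate; here; there)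
import Data.Vec as Vec
import Data.Vec.Properties as VecP
open import Data.Vec.Relation.Unary.All as VAll using ([]; _∷_)
open import Data.List as List using (List; []; _∷_; length)
import Data.List.Properties as ListP
open import Data.List.Membership.Propositional using () renaming (_∈_ to _∈ₗ_)
open import Data.List.Membership.Propositional.Properties using (∈-allFin; ∈-cartesianProductWith⁺)
open import Data.List.Relation.Unary.Any using (here; there)
open import Data.Bool using (Bool; true; false; not; T)
open import Data.Bool.ListAction using (and; or)
open import Data.Bool.Properties using (T-∧; T-∨; T-≡; T?) renaming (_≟_ to _≟ᵇ_)
open import Data.Product using (Σ; ∃; ∃₂; _×_; _,_; proj₁; proj₂)
open import Data.Product.Function.NonDependent.Propositional using (_×-⇔_)
open import Data.Sum using (_⊎_; inj₁; inj₂; [_,_]′)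
open import Data.Sum.Function.Propositional using (_⊎-⇔_)
open import Data.Empty using (⊥-elim)
open import Relation.Nullary using (¬_; yes; no; Dec; contradiction)
open import Relation.Nullary.Decidable using (⌊_⌋; toWitness; fromWitness; _→-dec_)
open import Relation.Binary.Definitions using (DecidableEquality)
open import Relation.Binary.PropositionalEquality
open import Function.Base using (_∘_)
open import Function.Definitions using (Injective)
open import Function.Bundles using (_⇔_; mk⇔; Equivalence)
open import Function.Related.TypeIsomorphisms using (¬-cong-⇔)
import Function.Properties.Equivalence as ⇔
open Equivalence using (to; from)

infix 7 ~_

data Formula (I : Set) : Set where
  var : I → Formula I
  ~_  : Formula I → Formula I
  ⋀ ⋁ : List (Formula I) → Formula I

module _ {I : Set} where

  mutual
    eval : (I → Bool) → Formula I → Bool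
    eval x (var i) = x i
    eval x (~ t)   = not (eval x t)
    eval x (⋀ ts)  = and (evalAll x ts)
    eval x (⋁ ts)  = or (evalAll x ts)

    evalAll : (I → Bool) → List (Formula I) → List Bool
    evalAll x []       = []
    evalAll x (t ∷ ts) = eval x t ∷ evalAll x ts

  mutual
    formulaSize : Formula I → ℕ
    formulaSize (var i) = 1
    formulaSize (~ t)   = suc (formulaSize t)
    formulaSize (⋀ ts)  = suc (sizeAll ts)
    formulaSize (⋁ ts)  = suc (sizeAll ts)

    sizeAll : List (Formula I) → ℕ
    sizeAll []       = 0
    sizeAll (t ∷ ts) = formulaSize t + sizeAll ts

  mutual
    formulaDepth : Formula I → ℕ
    formulaDepth (var i) = 0
    formulaDepth (~ t)   = suc (formulaDepth t)
    formulaDepth (⋀ ts)  = suc (maxDepth ts)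
    formulaDepth (⋁ ts)  = suc (maxDepth ts)

    maxDepth : List (Formula I) → ℕ
    maxDepth []       = 0
    maxDepth (t ∷ ts) = formulaDepth t ⊔ maxDepth ts

record Enumeration (A : Set) : Set where
  field
    elements : List A
    complete : ∀ a → a ∈ₗ elements
open Enumeration

card : ∀ {A} → Enumeration A → ℕ
card E = length (elements E)

allFins : (n : ℕ) → Enumeration (Fin n)
allFins n = record { elements = List.allFin n ; complete = ∈-allFin }

card-allFins : ∀ n → card (allFins n) ≡ n
card-allFins n = ListP.length-tabulate (λ i → i)

allVecs : ∀ {A} → Enumeration A → (k : ℕ) → Enumeration (Vec A k)
allVecs E zero    = record { elements = [] ∷ [] ; complete = λ { [] → here refl } }
allVecs E (suc k) = record
  { elements = List.cartesianProductWith _∷_ (elements E) (elements (allVecs E k))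
  ; complete = λ { (a ∷ as) → ∈-cartesianProductWith⁺ _∷_ (complete E a) (complete (allVecs E k) as) } }

bools : Enumeration Bool
bools = record
  { elements = true ∷ false ∷ []
  ; complete = λ { true → here refl ; false → there (here refl) } }

length-cartesianProductWith : ∀ {A B C : Set} (f : A → B → C) xs ys →
  length (List.cartesianProductWith f xs ys) ≡ length xs * length ys
length-cartesianProductWith f []       ys = refl
length-cartesianProductWith f (x ∷ xs) ys = begin
  length (List.map (f x) ys List.++ List.cartesianProductWith f xs ys)
    ≡⟨ ListP.length-++ (List.map (f x) ys) ⟩
  length (List.map (f x) ys) + length (List.cartesianProductWith f xs ys)
    ≡⟨ cong₂ _+_ (ListP.length-map (f x) ys) (length-cartesianProductWith f xs ys) ⟩
  length ys + length xs * length ys ∎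
  where open ≡-Reasoning

card-allVecs : ∀ {A} (E : Enumeration A) k → card (allVecs E k) ≡ card E ^ k
card-allVecs E zero    = refl
card-allVecs E (suc k) = trans (length-cartesianProductWith _∷_ (elements E) (elements (allVecs E k)))
                               (cong (card E *_) (card-allVecs E k))

module _ {I : Set} where

  ⊤F ⊥F : Formula I
  ⊤F = ⋀ []
  ⊥F = ⋁ []

  bool : Bool → Formula I
  bool true  = ⊤F
  bool false = ⊥F

  when : Bool → Formula I → Formula I
  when true  t = t
  when false t = ⊥F

  infixr 6 _∧F_
  infixr 5 _∨F_

  _∧F_ _∨F_ : Formula I → Formula I → Formula I
  s ∧F t = ⋀ (s ∷ t ∷ [])
  s ∨F t = ⋁ (s ∷ t ∷ [])

  ⋀[_]_ ⋁[_]_ : ∀ {A} → Enumeration A → (A → Formula I) → Formula I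
  ⋀[ E ] f = ⋀ (List.map f (elements E))
  ⋁[ E ] f = ⋁ (List.map f (elements E))

  module _ (x : I → Bool) where

    Holds : Formula I → Set
    Holds t = T (eval x t)

    holds-bool : ∀ b → Holds (bool b) ⇔ T b
    holds-bool true  = mk⇔ _ _
    holds-bool false = mk⇔ (λ ()) (λ ())

    holds-~ : ∀ t → Holds (~ t) ⇔ (¬ Holds t)
    holds-~ t with eval x t
    ... | true  = mk⇔ (λ ()) (λ h → h _)
    ... | false = mk⇔ (λ _ ()) _

    holds-when : ∀ b t → Holds (when b t) ⇔ (T b × Holds t)
    holds-when true  t = mk⇔ (_ ,_) proj₂
    holds-when false t = mk⇔ (λ ()) proj₁

    holds-∧F : ∀ s t → Holds (s ∧F t) ⇔ (Holds s × Holds t)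
    holds-∧F s t with eval x s | eval x t
    ... | true  | true  = mk⇔ _ _
    ... | true  | false = mk⇔ (λ ()) proj₂
    ... | false | _     = mk⇔ (λ ()) proj₁

    holds-∨F : ∀ s t → Holds (s ∨F t) ⇔ (Holds s ⊎ Holds t)
    holds-∨F s t with eval x s | eval x t
    ... | true  | _     = mk⇔ inj₁ _
    ... | false | true  = mk⇔ inj₂ _
    ... | false | false = mk⇔ (λ ()) [ (λ ()) , (λ ()) ]′

    module _ {A : Set} (f : A → Formula I) where

      holds-⋁-map : ∀ xs → Holds (⋁ (List.map f xs)) ⇔ ∃ λ a → a ∈ₗ xs × Holds (f a)
      holds-⋁-map []       = mk⇔ (λ ()) (λ { (_ , () , _) })
      holds-⋁-map (a ∷ xs) = mk⇔
        (λ h → [ (λ ha → a , here refl , ha)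
               , (λ hs → let b , b∈ , hb = to (holds-⋁-map xs) hs in b , there b∈ , hb) ]′ (to T-∨ h))
        λ { (b , here refl , hb) → from T-∨ (inj₁ hb)
          ; (b , there b∈ , hb)  → from T-∨ (inj₂ (from (holds-⋁-map xs) (b , b∈ , hb))) }

      holds-⋀-map : ∀ xs → Holds (⋀ (List.map f xs)) ⇔ (∀ a → a ∈ₗ xs → Holds (f a))
      holds-⋀-map []       = mk⇔ (λ _ _ ()) _
      holds-⋀-map (a ∷ xs) = mk⇔
        (λ h → let ha , hs = to T-∧ h in
          λ { b (here refl) → ha ; b (there b∈) → to (holds-⋀-map xs) hs b b∈ })
        (λ h → from T-∧ (h a (here refl) , from (holds-⋀-map xs) (λ b b∈ → h b (there b∈))))

      holds-⋁[] : ∀ E → Holds (⋁[ E ] f) ⇔ ∃ λ a → Holds (f a)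
      holds-⋁[] E = mk⇔ (λ h → let a , _ , ha = to (holds-⋁-map (elements E)) h in a , ha)
                        (λ (a , ha) → from (holds-⋁-map (elements E)) (a , complete E a , ha))

      holds-⋀[] : ∀ E → Holds (⋀[ E ] f) ⇔ (∀ a → Holds (f a))
      holds-⋀[] E = mk⇔ (λ h a → to (holds-⋀-map (elements E)) h a (complete E a))
                        (λ h → from (holds-⋀-map (elements E)) (λ a _ → h a))

module _ {I : Set} where

  sizeAll-map : ∀ {A : Set} (f : A → Formula I) {B} → (∀ a → formulaSize (f a) ≤ B) →
    ∀ xs → sizeAll (List.map f xs) ≤ length xs * B
  sizeAll-map f f≤B []       = z≤n
  sizeAll-map f f≤B (a ∷ xs) = +-mono-≤ (f≤B a) (sizeAll-map f f≤B xs)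

  maxDepth-map : ∀ {A : Set} (f : A → Formula I) {D} → (∀ a → formulaDepth (f a) ≤ D) →
    ∀ xs → maxDepth (List.map f xs) ≤ D
  maxDepth-map f f≤D []       = z≤n
  maxDepth-map f f≤D (a ∷ xs) = ⊔-lub (f≤D a) (maxDepth-map f f≤D xs)

  depth-⋁[] : ∀ {A} (E : Enumeration A) (f : A → Formula I) {D} →
    (∀ a → formulaDepth (f a) ≤ D) → formulaDepth (⋁[ E ] f) ≤ suc D
  depth-⋁[] E f f≤D = s≤s (maxDepth-map f f≤D (elements E))

  depth-⋀[] : ∀ {A} (E : Enumeration A) (f : A → Formula I) {D} →
    (∀ a → formulaDepth (f a) ≤ D) → formulaDepth (⋀[ E ] f) ≤ suc D
  depth-⋀[] = depth-⋁[]

  depth-when : ∀ b {t : Formula I} {D} → formulaDepth t ≤ D → formulaDepth (when b t) ≤ suc D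
  depth-when true  t≤D = m≤n⇒m≤1+n t≤D
  depth-when false _   = s≤s z≤n

  depth-∧F : ∀ {s t : Formula I} {D} →
    formulaDepth s ≤ D → formulaDepth t ≤ D → formulaDepth (s ∧F t) ≤ suc D
  depth-∧F s≤D t≤D = s≤s (⊔-lub s≤D (⊔-lub t≤D z≤n))

  depth-∨F : ∀ {s t : Formula I} {D} →
    formulaDepth s ≤ D → formulaDepth t ≤ D → formulaDepth (s ∨F t) ≤ suc D
  depth-∨F = depth-∧F

  depth-bool : ∀ b → formulaDepth {I} (bool b) ≤ 1
  depth-bool true  = ≤-refl
  depth-bool false = ≤-refl

module Sizes {I : Set} (n : ℕ) where

  N : ℕ
  N = suc n

  -- Coefficients are kept of the form s + 1, so that every bound is positive and absorbs the extra gate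
  -- of a connective.
  record Sized (s e : ℕ) (t : Formula I) : Set where
    constructor sized
    field size≤ : formulaSize t ≤ suc s * N ^ e
  open Sized public

  private
    1≤N^ : ∀ e → 1 ≤ N ^ e
    1≤N^ e = m^n>0 N e

    suc-absorb : ∀ m e → suc (m * N ^ e) ≤ suc m * N ^ e
    suc-absorb m e = +-monoˡ-≤ (m * N ^ e) (1≤N^ e)

  sized-weaken : ∀ {s s′ e e′} {t : Formula I} → s ≤ s′ → e ≤ e′ → Sized s e t → Sized s′ e′ t
  sized-weaken s≤s′ e≤e′ (sized t≤) =
    sized (≤-trans t≤ (*-mono-≤ (s≤s s≤s′) (^-monoʳ-≤ N e≤e′)))

  sized-var : ∀ i → Sized 0 0 (var i)
  sized-var i = sized ≤-refl

  sized-bool : ∀ b → Sized 0 0 (bool {I} b)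
  sized-bool true  = sized ≤-refl
  sized-bool false = sized ≤-refl

  sized-~ : ∀ {s e} {t : Formula I} → Sized s e t → Sized (suc s) e (~ t)
  sized-~ {s} {e} (sized t≤) = sized (≤-trans (s≤s t≤) (suc-absorb (suc s) e))

  sized-when : ∀ {s e} b {t : Formula I} → Sized s e t → Sized s e (when b t)
  sized-when           true  t≤ = t≤
  sized-when {s} {e} false _  = sized (≤-trans (1≤N^ e) (m≤n*m (N ^ e) (suc s)))

  sized-∧F : ∀ {s s′ e} {t u : Formula I} →
    Sized s e t → Sized s′ e u → Sized (suc (s + suc s′)) e (t ∧F u)
  sized-∧F {s} {s′} {e} {t} {u} (sized t≤) (sized u≤) = sized (begin
    suc (formulaSize t + (formulaSize u + 0))
      ≤⟨ s≤s (+-mono-≤ t≤ (≤-trans (≤-reflexive (+-identityʳ _)) u≤)) ⟩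
    suc (suc s * N ^ e + suc s′ * N ^ e)
      ≡⟨ cong suc (sym (*-distribʳ-+ (N ^ e) (suc s) (suc s′))) ⟩
    suc ((suc s + suc s′) * N ^ e)
      ≤⟨ suc-absorb (suc s + suc s′) e ⟩
    suc (suc s + suc s′) * N ^ e ∎)
    where open ≤-Reasoning

  sized-∨F : ∀ {s s′ e} {t u : Formula I} →
    Sized s e t → Sized s′ e u → Sized (suc (s + suc s′)) e (t ∨F u)
  sized-∨F t≤ u≤ = sized (size≤ (sized-∧F t≤ u≤))

  private
    sized-⋁[] : ∀ {A} (E : Enumeration A) (f : A → Formula I) ℓ d {s e} →
      card E ≤ ℓ * N ^ d → (∀ a → Sized s e (f a)) → Sized (ℓ * suc s) (d + e) (⋁[ E ] f)
    sized-⋁[] E f ℓ d {s} {e} card≤ f≤ = sized (begin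
      suc (sizeAll (List.map f (elements E)))
        ≤⟨ s≤s (sizeAll-map f (size≤ ∘ f≤) (elements E)) ⟩
      suc (card E * (suc s * N ^ e))
        ≤⟨ s≤s (*-monoˡ-≤ _ card≤) ⟩
      suc (ℓ * N ^ d * (suc s * N ^ e))
        ≡⟨ cong suc (regroup ℓ (N ^ d) (suc s) (N ^ e)) ⟩
      suc (ℓ * suc s * (N ^ d * N ^ e))
        ≡⟨ cong (λ p → suc (ℓ * suc s * p)) (^-distribˡ-+-* N d e) ⟨
      suc (ℓ * suc s * N ^ (d + e))
        ≤⟨ suc-absorb (ℓ * suc s) (d + e) ⟩
      suc (ℓ * suc s) * N ^ (d + e) ∎)
      where
      open ≤-Reasoning
      regroup : ∀ a b c d → a * b * (c * d) ≡ a * c * (b * d)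
      regroup = solve-∀

  sized-⋁[]-constant : ∀ {A} (E : Enumeration A) (f : A → Formula I) {m s e} →
    card E ≡ m → (∀ a → Sized s e (f a)) → Sized (m * suc s) e (⋁[ E ] f)
  sized-⋁[]-constant E f {m} refl = sized-⋁[] E f m 0 (≤-reflexive (sym (*-identityʳ m)))

  sized-⋁[]-linear : ∀ {A} (E : Enumeration A) (f : A → Formula I) ℓ {s e} →
    card E ≤ ℓ * N → (∀ a → Sized s e (f a)) → Sized (ℓ * suc s) (suc e) (⋁[ E ] f)
  sized-⋁[]-linear E f ℓ card≤ =
    sized-⋁[] E f ℓ 1 (≤-trans card≤ (≤-reflexive (cong (ℓ *_) (sym (*-identityʳ N)))))

  sized-⋀[]-constant : ∀ {A} (E : Enumeration A) (f : A → Formula I) {m s e} →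
    card E ≡ m → (∀ a → Sized s e (f a)) → Sized (m * suc s) e (⋀[ E ] f)
  sized-⋀[]-constant E f eq f≤ = sized (size≤ (sized-⋁[]-constant E f eq f≤))

  sized-⋀[]-linear : ∀ {A} (E : Enumeration A) (f : A → Formula I) ℓ {s e} →
    card E ≤ ℓ * N → (∀ a → Sized s e (f a)) → Sized (ℓ * suc s) (suc e) (⋀[ E ] f)
  sized-⋀[]-linear E f ℓ card≤ f≤ = sized (size≤ (sized-⋁[]-linear E f ℓ card≤ f≤))

  card-allFins≤N : card (allFins n) ≤ 1 * N
  card-allFins≤N = ≤-trans (≤-reflexive (card-allFins n)) (≤-trans (n≤1+n n) (m≤n*m N 1))

-- Compiling formulas into circuits

module _ {A : Set} where

  lookup-∷ʳ-inject₁ : ∀ {n} (xs : Vec A n) y i → lookup (xs ∷ʳ y) (inject₁ i) ≡ lookup xs i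
  lookup-∷ʳ-inject₁ (x ∷ xs) y zero    = refl
  lookup-∷ʳ-inject₁ (x ∷ xs) y (suc i) = lookup-∷ʳ-inject₁ xs y i

  lookup-∷ʳ-fromℕ : ∀ {n} (xs : Vec A n) y → lookup (xs ∷ʳ y) (fromℕ n) ≡ y
  lookup-∷ʳ-fromℕ []       y = refl
  lookup-∷ʳ-fromℕ (x ∷ xs) y = lookup-∷ʳ-fromℕ xs y

  last≡lookup-fromℕ : ∀ {n} (xs : Vec A (suc n)) → last xs ≡ lookup xs (fromℕ n)
  last≡lookup-fromℕ (x ∷ [])     = refl
  last≡lookup-fromℕ (x ∷ y ∷ xs) = last≡lookup-fromℕ (y ∷ xs)

  All-∷ʳ : ∀ {P : A → Set} {n} {xs : Vec A n} {y} → VAll.All P xs → P y → VAll.All P (xs ∷ʳ y)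
  All-∷ʳ []         py = py ∷ []
  All-∷ʳ (px ∷ pxs) py = px ∷ All-∷ʳ pxs py

foldr-⊔-lub : ∀ {n D} {xs : Vec ℕ n} → VAll.All (_≤ D) xs → Vec.foldr _ _⊔_ 0 xs ≤ D
foldr-⊔-lub []         = z≤n
foldr-⊔-lub (px ∷ pxs) = ⊔-lub px (foldr-⊔-lub pxs)

module Compilation {I : Set} where

  record _≼_ {j j′} (c : Circuit I j) (c′ : Circuit I j′) : Set where
    field
      embed       : Fin j → Fin j′
      embed-value : ∀ x i → lookup (values c′ x) (embed i) ≡ lookup (values c x) i
      embed-depth : ∀ i → lookup (depths c′) (embed i) ≡ lookup (depths c) i
  open _≼_

  ≼-refl : ∀ {j} {c : Circuit I j} → c ≼ c
  ≼-refl = record { embed = λ i → i ; embed-value = λ _ _ → refl ; embed-depth = λ _ → refl }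

  ≼-trans : ∀ {j₁ j₂ j₃} {c₁ : Circuit I j₁} {c₂ : Circuit I j₂} {c₃ : Circuit I j₃} →
    c₁ ≼ c₂ → c₂ ≼ c₃ → c₁ ≼ c₃
  ≼-trans e₁ e₂ = record
    { embed       = λ i → embed e₂ (embed e₁ i)
    ; embed-value = λ x i → trans (embed-value e₂ x (embed e₁ i)) (embed-value e₁ x i)
    ; embed-depth = λ i → trans (embed-depth e₂ (embed e₁ i)) (embed-depth e₁ i) }

  ≼-▷ : ∀ {j} (c : Circuit I j) (g : Gate I j) → c ≼ (c ▷ g)
  ≼-▷ c g = record
    { embed       = inject₁
    ; embed-value = λ x → lookup-∷ʳ-inject₁ (values c x) _
    ; embed-depth = lookup-∷ʳ-inject₁ (depths c) _ }

  DepthBounded : ∀ {j} → ℕ → Circuit I j → Set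
  DepthBounded D c = VAll.All (_≤ D) (depths c)

  record Compiled {j} (c : Circuit I j) (t : Formula I) : Set where
    field
      {gates}       : ℕ
      circuit       : Circuit I (suc gates)
      extends       : c ≼ circuit
      value         : ∀ x → lookup (values circuit x) (fromℕ gates) ≡ eval x t
      value-depth   : lookup (depths circuit) (fromℕ gates) ≤ formulaDepth t
      gates≡        : suc gates ≡ j + formulaSize t
      depth-bounded : ∀ {D} → DepthBounded D c → formulaDepth t ≤ D → DepthBounded D circuit

  record CompiledAll {j} (c : Circuit I j) (ts : List (Formula I)) : Set where
    field
      {gates}       : ℕ
      circuit       : Circuit I gates
      extends       : c ≼ circuit
      outputs       : List (Fin gates)
      values≡       : ∀ x → List.map (lookup (values circuit x)) outputs ≡ evalAll x ts
      outputs-depth : List.foldr _⊔_ 0 (List.map (lookup (depths circuit)) outputs) ≤ maxDepth ts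
      gates≡        : gates ≡ j + sizeAll ts
      depth-bounded : ∀ {D} → DepthBounded D c → maxDepth ts ≤ D → DepthBounded D circuit

  appendGate : ∀ {j j₁} {c : Circuit I j} {t : Formula I} (c₁ : Circuit I j₁) (g : Gate I j₁) →
    c ≼ c₁ →
    (∀ x → gateVal g x (values c₁ x) ≡ eval x t) →
    gateDepth g (depths c₁) ≤ formulaDepth t →
    suc j₁ ≡ j + formulaSize t →
    (∀ {D} → DepthBounded D c → formulaDepth t ≤ D → DepthBounded D c₁) →
    Compiled c t
  appendGate c₁ g ext val dep size bnd = record
    { circuit       = c₁ ▷ g
    ; extends       = ≼-trans ext (≼-▷ c₁ g)
    ; value         = λ x → trans (lookup-∷ʳ-fromℕ (values c₁ x) _) (val x)
    ; value-depth   = ≤-trans (≤-reflexive (lookup-∷ʳ-fromℕ (depths c₁) _)) dep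
    ; gates≡        = size
    ; depth-bounded = λ bc d≤D → All-∷ʳ (bnd bc d≤D) (≤-trans dep d≤D) }

  private
    gates-suc : ∀ {j₁ j s} → j₁ ≡ j + s → suc j₁ ≡ j + suc s
    gates-suc {j = j} eq = trans (cong suc eq) (sym (+-suc j _))

  mutual
    compile : ∀ {j} (c : Circuit I j) (t : Formula I) → Compiled c t
    compile {j} c (var i) = appendGate c (input i) ≼-refl (λ _ → refl) z≤n (+-comm 1 j) (λ bc _ → bc)
    compile c (~ t) =
      appendGate circuit (NOT (fromℕ gates)) extends (λ x → cong not (value x)) (s≤s value-depth)
        (gates-suc gates≡) (λ bc d<D → depth-bounded bc (<⇒≤ d<D))
      where open Compiled (compile c t)
    compile c (⋀ ts) =
      appendGate circuit (AND outputs) extends (λ x → cong and (values≡ x)) (s≤s outputs-depth)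
        (gates-suc gates≡) (λ bc d<D → depth-bounded bc (<⇒≤ d<D))
      where open CompiledAll (compileAll c ts)
    compile c (⋁ ts) =
      appendGate circuit (OR outputs) extends (λ x → cong or (values≡ x)) (s≤s outputs-depth)
        (gates-suc gates≡) (λ bc d<D → depth-bounded bc (<⇒≤ d<D))
      where open CompiledAll (compileAll c ts)

    compileAll : ∀ {j} (c : Circuit I j) (ts : List (Formula I)) → CompiledAll c ts
    compileAll {j} c [] = record
      { circuit = c ; extends = ≼-refl ; outputs = [] ; values≡ = λ _ → refl
      ; outputs-depth = z≤n ; gates≡ = sym (+-identityʳ j) ; depth-bounded = λ bc _ → bc }
    compileAll {j} c (t ∷ ts) = record
      { circuit       = R.circuit
      ; extends       = ≼-trans H.extends R.extends
      ; outputs       = embed R.extends (fromℕ H.gates) ∷ R.outputs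
      ; values≡       = λ x → cong₂ _∷_ (trans (embed-value R.extends x _) (H.value x)) (R.values≡ x)
      ; outputs-depth = ⊔-mono-≤ (≤-trans (≤-reflexive (embed-depth R.extends _)) H.value-depth)
                                 R.outputs-depth
      ; gates≡        = trans R.gates≡ (trans (cong (_+ sizeAll ts) H.gates≡)
                          (+-assoc j (formulaSize t) (sizeAll ts)))
      ; depth-bounded = λ bc d≤D → R.depth-bounded (H.depth-bounded bc (≤-trans (m≤m⊔n _ _) d≤D))
                                                   (≤-trans (m≤n⊔m _ _) d≤D) }
      where
      module H = Compiled (compile c t)
      module R = CompiledAll (compileAll H.circuit ts)

  record CircuitFor (t : Formula I) : Set where
    field
      {gates}     : ℕ
      circuit     : Circuit I (suc gates)
      gates≡size  : suc gates ≡ formulaSize t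
      output≡eval : ∀ x → output circuit x ≡ eval x t
      depth≤      : depth circuit ≤ formulaDepth t

  formulaCircuit : (t : Formula I) → CircuitFor t
  formulaCircuit t = record
    { circuit     = circuit
    ; gates≡size  = gates≡
    ; output≡eval = λ x → trans (last≡lookup-fromℕ (values circuit x)) (value x)
    ; depth≤      = foldr-⊔-lub (depth-bounded [] ≤-refl) }
    where open Compiled (compile [] t)

  output≡true⇔holds : ∀ {t} (C : CircuitFor t) x →
    (output (CircuitFor.circuit C) x ≡ true) ⇔ Holds x t
  output≡true⇔holds C x =
    ⇔.trans (mk⇔ (trans (sym (output≡eval x))) (trans (output≡eval x))) (⇔.sym T-≡)
    where open CircuitFor C

-- Counting subsets

rank : ∀ {n} {p : Subset n} {i} → i ∈ p → Fin ∣ p ∣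
rank {p = true  ∷ p} here        = zero
rank {p = true  ∷ p} (there i∈p) = suc (rank i∈p)
rank {p = false ∷ p} (there i∈p) = rank i∈p

rank-injective : ∀ {n} {p : Subset n} {i j} (i∈p : i ∈ p) (j∈p : j ∈ p) →
  rank i∈p ≡ rank j∈p → i ≡ j
rank-injective {p = true  ∷ p} here        here        _  = refl
rank-injective {p = true  ∷ p} (there i∈p) (there j∈p) eq =
  cong suc (rank-injective i∈p j∈p (suc-injective eq))
rank-injective {p = false ∷ p} (there i∈p) (there j∈p) eq = cong suc (rank-injective i∈p j∈p eq)

member : ∀ {n} (p : Subset n) → Fin ∣ p ∣ → Fin n
member (true  ∷ p) zero    = zero
member (true  ∷ p) (suc r) = suc (member p r)
member (false ∷ p) r       = suc (member p r)

member-∈ : ∀ {n} (p : Subset n) r → member p r ∈ p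
member-∈ (true  ∷ p) zero    = here
member-∈ (true  ∷ p) (suc r) = there (member-∈ p r)
member-∈ (false ∷ p) r       = there (member-∈ p r)

member-injective : ∀ {n} (p : Subset n) → Injective _≡_ _≡_ (member p)
member-injective (true  ∷ p) {zero}  {zero}  _  = refl
member-injective (true  ∷ p) {suc r} {suc s} eq = cong suc (member-injective p (suc-injective eq))
member-injective (false ∷ p)                 eq = member-injective p (suc-injective eq)

Embedding : ∀ {n} → ℕ → Subset n → Set
Embedding {n} t p = ∃ λ (f : Fin t → Fin n) → Injective _≡_ _≡_ f × (∀ r → f r ∈ p)

embedding⇒≤∣p∣ : ∀ {n t} {p : Subset n} → Embedding t p → t ≤ ∣ p ∣
embedding⇒≤∣p∣ (f , f-inj , f∈p) = injective⇒≤ (λ eq → f-inj (rank-injective (f∈p _) (f∈p _) eq))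

≤∣p∣⇒embedding : ∀ {n t} {p : Subset n} → t ≤ ∣ p ∣ → Embedding t p
≤∣p∣⇒embedding {p = p} t≤∣p∣ =
  (λ r → member p (inject≤ r t≤∣p∣)) ,
  (λ eq → inject≤-injective t≤∣p∣ t≤∣p∣ _ _ (member-injective p eq)) ,
  (λ r → member-∈ p _)

⊆-interpolate : ∀ {n} {F P : Subset n} {t} → F ⊆ P → ∣ F ∣ ≤ t → t ≤ ∣ P ∣ →
  ∃ λ C → F ⊆ C × C ⊆ P × ∣ C ∣ ≡ t
⊆-interpolate {F = []} {[]} _ _ t≤0 = [] , (λ ()) , (λ ()) , sym (n≤0⇒n≡0 t≤0)
⊆-interpolate {F = true ∷ F} {true ∷ P} {suc t} F⊆P (s≤s F≤t) (s≤s t≤P) =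
  let C , F⊆C , C⊆P , ∣C∣≡t = ⊆-interpolate (drop-∷-⊆ F⊆P) F≤t t≤P
  in true ∷ C , in⊆in F⊆C , in⊆in C⊆P , cong suc ∣C∣≡t
⊆-interpolate {F = true ∷ F} {false ∷ P} F⊆P _ _ with () ← F⊆P here
⊆-interpolate {F = false ∷ F} {false ∷ P} F⊆P F≤t t≤P =
  let C , F⊆C , C⊆P , ∣C∣≡t = ⊆-interpolate (drop-∷-⊆ F⊆P) F≤t t≤P
  in false ∷ C , out⊆ F⊆C , out⊆ C⊆P , ∣C∣≡t
⊆-interpolate {F = false ∷ F} {true ∷ P} {t} F⊆P F≤t t≤1+P with t ≤? ∣ P ∣
... | yes t≤P =
  let C , F⊆C , C⊆P , ∣C∣≡t = ⊆-interpolate (drop-∷-⊆ F⊆P) F≤t t≤P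
  in false ∷ C , out⊆ F⊆C , out⊆ C⊆P , ∣C∣≡t
... | no t≰P with t | t≤1+P
...   | zero   | _        = contradiction z≤n t≰P
...   | suc t′ | s≤s t′≤P =
  let F≤t′ = ≤-trans (p⊆q⇒∣p∣≤∣q∣ (drop-∷-⊆ F⊆P)) (≤-pred (≰⇒> t≰P))
      C , F⊆C , C⊆P , ∣C∣≡t′ = ⊆-interpolate (drop-∷-⊆ F⊆P) F≤t′ t′≤P
  in true ∷ C , out⊆ F⊆C , in⊆in C⊆P , cong suc ∣C∣≡t′

Window : Cmp → ℕ → ℕ → ℕ → Set
Window EQ f p k = f ≤ k × k ≤ p
Window LE f p k = f ≤ k
Window GE f p k = k ≤ p

⊆-interpolate-cmp : ∀ {n} {F P : Subset n} ⋈ {k} →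
  (F ⊆ P × Window ⋈ ∣ F ∣ ∣ P ∣ k) ⇔ (∃ λ C → (F ⊆ C × C ⊆ P) × cmp ⋈ ∣ C ∣ k)
⊆-interpolate-cmp {F = F} {P} ⋈ =
  mk⇔ (interpolate ⋈) (λ (C , (F⊆C , C⊆P) , C⋈k) → ⊆-trans F⊆C C⊆P , bounds ⋈ F⊆C C⊆P C⋈k)
  where
  interpolate : ∀ ⋈ {k} → F ⊆ P × Window ⋈ ∣ F ∣ ∣ P ∣ k →
    ∃ λ C → (F ⊆ C × C ⊆ P) × cmp ⋈ ∣ C ∣ k
  interpolate EQ (F⊆P , F≤k , k≤P) =
    let C , F⊆C , C⊆P , ∣C∣≡k = ⊆-interpolate F⊆P F≤k k≤P in C , (F⊆C , C⊆P) , ∣C∣≡k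
  interpolate LE (F⊆P , F≤k) = F , (⊆-refl , F⊆P) , F≤k
  interpolate GE (F⊆P , k≤P) = P , (F⊆P , ⊆-refl) , k≤P
  bounds : ∀ ⋈ {k C} → F ⊆ C → C ⊆ P → cmp ⋈ ∣ C ∣ k → Window ⋈ ∣ F ∣ ∣ P ∣ k
  bounds EQ F⊆C C⊆P refl = p⊆q⇒∣p∣≤∣q∣ F⊆C , p⊆q⇒∣p∣≤∣q∣ C⊆P
  bounds LE F⊆C C⊆P C≤k  = ≤-trans (p⊆q⇒∣p∣≤∣q∣ F⊆C) C≤k
  bounds GE F⊆C C⊆P k≤C  = ≤-trans k≤C (p⊆q⇒∣p∣≤∣q∣ C⊆P)


-- Separating words by few positions, binary codes

module Separation {A : Set} (_≟_ : DecidableEquality A) where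

  project : ∀ {L t} → Vec (Fin L) t → Vec A L → Vec A t
  project cs w = Vec.map (lookup w) cs

  differ : ∀ {L} {u w : Vec A L} → u ≢ w → ∃ λ c → lookup u c ≢ lookup w c
  differ {L} {u} {w} u≢w = ¬∀⟶∃¬ L _ (λ c → lookup u c ≟ lookup w c) (u≢w ∘ lookup-ext)
    where
    lookup-ext : (∀ c → lookup u c ≡ lookup w c) → u ≡ w
    lookup-ext u≗w =
      trans (sym (VecP.tabulate∘lookup u)) (trans (VecP.tabulate-cong u≗w) (VecP.tabulate∘lookup w))

  -- A position where the head of g and its only possible collision partner b₀ differ separates all of g.
  separate-step : ∀ {L t} (g : Fin (suc (suc t)) → Vec A L) (cs : Vec (Fin L) t) →
    Injective _≡_ _≡_ (project cs ∘ g ∘ suc) →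
    (b₀ : Fin (suc t)) → (∀ b → project cs (g (suc b)) ≡ project cs (g zero) → b ≡ b₀) →
    g zero ≢ g (suc b₀) →
    ∃ λ c → Injective _≡_ _≡_ (project (c ∷ cs) ∘ g)
  separate-step {L} g cs cs-inj b₀ only-b₀ g₀≢g₁₊b₀ = c , injective
    where
    c : Fin L
    c = proj₁ (differ g₀≢g₁₊b₀)
    head-separated : ∀ b → project (c ∷ cs) (g zero) ≢ project (c ∷ cs) (g (suc b))
    head-separated b eq with VecP.∷-injective eq
    ... | c-eq , T-eq with only-b₀ b (sym T-eq)
    ... | refl = proj₂ (differ g₀≢g₁₊b₀) c-eq
    injective : Injective _≡_ _≡_ (project (c ∷ cs) ∘ g)
    injective {zero}  {zero}  _  = refl
    injective {zero}  {suc b} eq = ⊥-elim (head-separated b eq)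
    injective {suc b} {zero}  eq = ⊥-elim (head-separated b (sym eq))
    injective {suc _} {suc _} eq = cong suc (cs-inj (proj₂ (VecP.∷-injective eq)))

  separate : ∀ {L t} (g : Fin (suc t) → Vec A L) → Injective _≡_ _≡_ g →
    ∃ λ (cs : Vec (Fin L) t) → Injective _≡_ _≡_ (project cs ∘ g)
  separate {t = zero}  g _     = [] , λ { {zero} {zero} _ → refl }
  separate {t = suc t} g g-inj with separate (g ∘ suc) (suc-injective ∘ g-inj)
  ... | cs , cs-inj with any? (λ b → VecP.≡-dec _≟_ (project cs (g (suc b))) (project cs (g zero)))
  ...   | yes (b₀ , collision) =
    let c , inj = separate-step g cs cs-inj b₀ (λ b eq → cs-inj (trans eq (sym collision))) (0≢1+n ∘ g-inj)
    in c ∷ cs , inj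
  ...   | no no-collision =
    let c , inj = separate-step g cs cs-inj zero (λ b eq → contradiction (b , eq) no-collision) (0≢1+n ∘ g-inj)
    in c ∷ cs , inj

funToFin-cong : ∀ {m n} {f g : Fin m → Fin n} → f ≗ g → funToFin f ≡ funToFin g
funToFin-cong {zero}  f≗g = refl
funToFin-cong {suc m} f≗g = cong₂ combine (f≗g zero) (funToFin-cong (f≗g ∘ suc))

binaryCode : ∀ {n} L → n ≤ 2 ^ L → Fin n → Vec (Fin 2) L
binaryCode L n≤2^L i = tabulate (finToFun (inject≤ i n≤2^L))

binaryCode-injective : ∀ {n} L (n≤2^L : n ≤ 2 ^ L) → Injective _≡_ _≡_ (binaryCode L n≤2^L)
binaryCode-injective {n} L n≤2^L {i} {j} eq = inject≤-injective n≤2^L n≤2^L i j (begin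
  inject≤ i n≤2^L       ≡⟨ funToFin-finToFin {L} {2} (inject≤ i n≤2^L) ⟨
  funToFin (digits i)   ≡⟨ funToFin-cong digits≡ ⟩
  funToFin (digits j)   ≡⟨ funToFin-finToFin {L} {2} (inject≤ j n≤2^L) ⟩
  inject≤ j n≤2^L       ∎)
  where
  open ≡-Reasoning
  digits : Fin n → Fin L → Fin 2
  digits i = finToFun (inject≤ i n≤2^L)
  digits≡ : digits i ≗ digits j
  digits≡ c = trans (sym (VecP.lookup∘tabulate (digits i) c))
                    (trans (cong (λ v → lookup v c) eq) (VecP.lookup∘tabulate (digits j) c))

binaryLength : ∀ n → ∃ λ L → n ≤ 2 ^ L × 2 ^ L ≤ 2 * suc n
binaryLength zero = 0 , z≤n , s≤s z≤n
binaryLength (suc n) with binaryLength n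
... | L , n≤2^L , 2^L≤ with suc n ≤? 2 ^ L
...   | yes 1+n≤2^L = L , 1+n≤2^L , ≤-trans 2^L≤ (*-monoʳ-≤ 2 (n≤1+n (suc n)))
...   | no  1+n≰2^L =
  suc L , ≤-trans 1+n≤2n (≤-reflexive (cong (2 *_) (sym 2^L≡n))) ,
          ≤-trans (≤-reflexive (cong (2 *_) 2^L≡n)) (*-monoʳ-≤ 2 (≤-trans (n≤1+n n) (n≤1+n (suc n))))
  where
  2^L≡n : 2 ^ L ≡ n
  2^L≡n = ≤-antisym (≤-pred (≰⇒> 1+n≰2^L)) n≤2^L
  1+n≤2n : suc n ≤ 2 * n
  1+n≤2n = begin
    suc n     ≤⟨ +-monoˡ-≤ n (subst (1 ≤_) 2^L≡n (m^n>0 2 L)) ⟩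
    n + n     ≡⟨ cong (n +_) (sym (+-identityʳ n)) ⟩
    2 * n     ∎
    where open ≤-Reasoning

^-distribʳ-* : ∀ m n k → (m * n) ^ k ≡ m ^ k * n ^ k
^-distribʳ-* m n zero    = refl
^-distribʳ-* m n (suc k) = trans (cong (m * n *_) (^-distribʳ-* m n k)) (interchange m n (m ^ k) (n ^ k))
  where
  interchange : ∀ a b c d → a * b * (c * d) ≡ a * c * (b * d)
  interchange = solve-∀

n<2^n : ∀ n → n < 2 ^ n
n<2^n zero    = s≤s z≤n
n<2^n (suc n) = begin-strict
  suc n           <⟨ s≤s (n<2^n n) ⟩
  suc (2 ^ n)     ≤⟨ +-monoˡ-≤ (2 ^ n) (m^n>0 2 n) ⟩
  2 ^ n + 2 ^ n   ≡⟨ cong (2 ^ n +_) (sym (+-identityʳ (2 ^ n))) ⟩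
  2 ^ suc n       ∎
  where open ≤-Reasoning

-- With q = ⌊L / k⌋ + 1 one has L < q k ≤ L + k, hence L^k ≤ (q k)^k ≤ (2^q)^k k^k ≤ 2^(L + k) k^k.
polylog≤exp : ∀ k L → L ^ k ≤ k ^ k * 2 ^ k * 2 ^ L
polylog≤exp zero      L = ≤-trans (m^n>0 2 L) (≤-reflexive (sym (+-identityʳ (2 ^ L))))
polylog≤exp k@(suc _) L = begin
  L ^ k                   ≤⟨ ^-monoˡ-≤ k (<⇒≤ L<qk) ⟩
  (q * k) ^ k             ≡⟨ ^-distribʳ-* q k k ⟩
  q ^ k * k ^ k           ≤⟨ *-monoˡ-≤ (k ^ k) (^-monoˡ-≤ k (<⇒≤ (n<2^n q))) ⟩
  (2 ^ q) ^ k * k ^ k     ≡⟨ cong (_* k ^ k) (^-*-assoc 2 q k) ⟩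
  2 ^ (q * k) * k ^ k     ≤⟨ *-monoˡ-≤ (k ^ k) (^-monoʳ-≤ 2 qk≤L+k) ⟩
  2 ^ (L + k) * k ^ k     ≡⟨ cong (_* k ^ k) (^-distribˡ-+-* 2 L k) ⟩
  2 ^ L * 2 ^ k * k ^ k   ≡⟨ reverse (2 ^ L) (2 ^ k) (k ^ k) ⟩
  k ^ k * 2 ^ k * 2 ^ L   ∎
  where
  open ≤-Reasoning
  reverse : ∀ x y z → x * y * z ≡ z * y * x
  reverse = solve-∀
  q : ℕ
  q = L / k + 1
  qk≡ : q * k ≡ L / k * k + k
  qk≡ = trans (*-distribʳ-+ k (L / k) 1) (cong (L / k * k +_) (*-identityˡ k))
  L<qk : L < q * k
  L<qk = begin-strict
    L                   ≡⟨ m≡m%n+[m/n]*n L k ⟩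
    L % k + L / k * k   <⟨ +-monoˡ-< (L / k * k) (m%n<n L k) ⟩
    k + L / k * k       ≡⟨ +-comm k (L / k * k) ⟩
    L / k * k + k       ≡⟨ qk≡ ⟨
    q * k               ∎
  qk≤L+k : q * k ≤ L + k
  qk≤L+k = ≤-trans (≤-reflexive qk≡) (+-monoˡ-≤ k (m/n*n≤m L k))

-- Threshold formulas

thresholdCoeff : (alphabet : ℕ) (positions : ℕ → ℕ) (bit : ℕ) → ℕ → ℕ
thresholdCoeff alphabet positions bit zero    = 0
thresholdCoeff alphabet positions bit (suc k) =
  positions k * suc ((alphabet ^ k) ^ suc k * suc (suc k * suc (1 * suc bit)))

module Threshold {I A : Set} (_≟_ : DecidableEquality A) (alphabet : Enumeration A)
                 {n L : ℕ} (code : Fin n → Vec A L) (code-injective : Injective _≡_ _≡_ code)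
                 (bit : Fin n → Formula I) where
  open Separation _≟_
  open Sizes {I} n

  Distinct : ∀ {k m} → Vec (Vec A k) m → Set
  Distinct V = ∀ i j → lookup V i ≡ lookup V j → i ≡ j

  distinct? : ∀ {k m} (V : Vec (Vec A k) m) → Dec (Distinct V)
  distinct? V = all? λ i → all? λ j → VecP.≡-dec _≟_ (lookup V i) (lookup V j) →-dec (i ≟ᶠ j)

  hit : ∀ {k} → Vec (Fin L) k → Vec A k → Fin n → Formula I
  hit cs w i = when ⌊ VecP.≡-dec _≟_ (project cs (code i)) w ⌋ (bit i)

  column : ∀ {k} → Vec (Fin L) k → Vec A k → Formula I
  column cs w = ⋁[ allFins n ] hit cs w

  block : ∀ {k} → Vec (Fin L) k → Vec (Vec A k) (suc k) → Formula I
  block {k} cs V = when ⌊ distinct? V ⌋ (⋀[ allFins (suc k) ] λ j → column cs (lookup V j))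

  positions : ∀ k → Enumeration (Vec (Fin L) k)
  positions = allVecs (allFins L)

  patterns : ∀ k → Enumeration (Vec (Vec A k) (suc k))
  patterns k = allVecs (allVecs alphabet k) (suc k)

  atLeast : ℕ → Formula I
  atLeast zero    = ⊤F
  atLeast (suc k) = ⋁[ positions k ] λ cs → ⋁[ patterns k ] block cs

  module _ (x : I → Bool) where

    truths : Subset n
    truths = tabulate (λ i → eval x (bit i))

    ∈-truths : ∀ {i} → i ∈ truths ⇔ Holds x (bit i)
    ∈-truths {i} = mk⇔
      (λ i∈ → from T-≡ (trans (sym (VecP.lookup∘tabulate _ i)) (VecP.[]=⇒lookup i∈)))
      (λ h → VecP.lookup⇒[]= i truths (trans (VecP.lookup∘tabulate _ i) (to T-≡ h)))

    holds-column : ∀ {k} (cs : Vec (Fin L) k) w →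
      Holds x (column cs w) ⇔ ∃ λ i → project cs (code i) ≡ w × Holds x (bit i)
    holds-column cs w = mk⇔
      (λ h → let i , hi = to (holds-⋁[] x (hit cs w) (allFins n)) h
                 d , hb = to (holds-hit i) hi
             in i , toWitness d , hb)
      (λ (i , eq , hb) →
         from (holds-⋁[] x (hit cs w) (allFins n)) (i , from (holds-hit i) (fromWitness eq , hb)))
      where
      holds-hit : ∀ i →
        Holds x (hit cs w i) ⇔ (T ⌊ VecP.≡-dec _≟_ (project cs (code i)) w ⌋ × Holds x (bit i))
      holds-hit i = holds-when x ⌊ VecP.≡-dec _≟_ (project cs (code i)) w ⌋ (bit i)

    Realised : ∀ {k} → Vec (Fin L) k → Vec (Vec A k) (suc k) → Set
    Realised cs V = Distinct V × ∀ j → ∃ λ i → project cs (code i) ≡ lookup V j × Holds x (bit i)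

    holds-block : ∀ {k} (cs : Vec (Fin L) k) V → Holds x (block cs V) ⇔ Realised cs V
    holds-block {k} cs V = mk⇔
      (λ h → let d , hs = to (holds-when x ⌊ distinct? V ⌋ columns) h
             in toWitness d , λ j → to (holds-column cs (lookup V j)) (to holds-columns hs j))
      (λ (dist , hits) → from (holds-when x ⌊ distinct? V ⌋ columns)
         (fromWitness dist , from holds-columns λ j → from (holds-column cs (lookup V j)) (hits j)))
      where
      columns : Formula I
      columns = ⋀[ allFins (suc k) ] λ j → column cs (lookup V j)
      holds-columns : Holds x columns ⇔ (∀ j → Holds x (column cs (lookup V j)))
      holds-columns = holds-⋀[] x (λ j → column cs (lookup V j)) (allFins (suc k))

    holds-atLeast-suc : ∀ k → Holds x (atLeast (suc k)) ⇔ ∃₂ λ cs V → Realised {k} cs V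
    holds-atLeast-suc k = mk⇔
      (λ h → let cs , hcs = to (holds-⋁[] x _ (positions k)) h
                 V , hV = to (holds-⋁[] x (block cs) (patterns k)) hcs
             in cs , V , to (holds-block cs V) hV)
      (λ (cs , V , r) → from (holds-⋁[] x _ (positions k))
                          (cs , from (holds-⋁[] x (block cs) (patterns k)) (V , from (holds-block cs V) r)))

    realised⇒≤ : ∀ {k} (cs : Vec (Fin L) k) V → Realised cs V → suc k ≤ ∣ truths ∣
    realised⇒≤ {k} cs V (dist , hits) =
      embedding⇒≤∣p∣ (f , f-inj , λ j → from ∈-truths (proj₂ (proj₂ (hits j))))
      where
      f : Fin (suc k) → Fin n
      f j = proj₁ (hits j)
      f-inj : Injective _≡_ _≡_ f
      f-inj {a} {b} eq = dist a b (trans (sym (proj₁ (proj₂ (hits a))))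
                               (trans (cong (project cs ∘ code) eq) (proj₁ (proj₂ (hits b)))))

    ≤⇒realised : ∀ {k} → suc k ≤ ∣ truths ∣ → ∃₂ λ cs V → Realised {k} cs V
    ≤⇒realised {k} k<∣truths∣ with ≤∣p∣⇒embedding k<∣truths∣
    ... | g , g-inj , g∈ with separate (code ∘ g) (g-inj ∘ code-injective)
    ... | cs , cs-inj = cs , V , dist , λ j → g j , sym (lookup-V j) , to ∈-truths (g∈ j)
      where
      V : Vec (Vec A k) (suc k)
      V = tabulate (project cs ∘ code ∘ g)
      lookup-V : ∀ j → lookup V j ≡ project cs (code (g j))
      lookup-V = VecP.lookup∘tabulate (project cs ∘ code ∘ g)
      dist : Distinct V
      dist a b eq = cs-inj (trans (sym (lookup-V a)) (trans eq (lookup-V b)))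

    atLeast-correct : ∀ k → Holds x (atLeast k) ⇔ (k ≤ ∣ truths ∣)
    atLeast-correct zero    = mk⇔ (λ _ → z≤n) _
    atLeast-correct (suc k) =
      mk⇔ (λ h → let cs , V , r = to (holds-atLeast-suc k) h in realised⇒≤ cs V r)
          (from (holds-atLeast-suc k) ∘ ≤⇒realised)

  atLeast-sized : ∀ {s} (p : ℕ → ℕ) → (∀ k → L ^ k ≤ p k * N) → (∀ i → Sized s 0 (bit i)) →
    ∀ k → Sized (thresholdCoeff (card alphabet) p s k) 2 (atLeast k)
  atLeast-sized p L^k≤ bit≤ zero    = sized-weaken z≤n z≤n (sized-bool true)
  atLeast-sized p L^k≤ bit≤ (suc k) =
    sized-⋁[]-linear (positions k) _ (p k) (≤-trans (≤-reflexive positions-card) (L^k≤ k)) λ cs →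
    sized-⋁[]-constant (patterns k) _ patterns-card λ V →
    sized-when _ (sized-⋀[]-constant (allFins (suc k)) _ (card-allFins (suc k)) λ j →
    sized-⋁[]-linear (allFins n) _ 1 card-allFins≤N λ i →
    sized-when _ (bit≤ i))
    where
    positions-card : card (positions k) ≡ L ^ k
    positions-card = trans (card-allVecs (allFins L) k) (cong (_^ k) (card-allFins L))
    patterns-card : card (patterns k) ≡ (card alphabet ^ k) ^ suc k
    patterns-card =
      trans (card-allVecs (allVecs alphabet k) (suc k)) (cong (_^ suc k) (card-allVecs alphabet k))

  atLeast-depth : ∀ {D} → (∀ i → formulaDepth (bit i) ≤ D) → ∀ k → formulaDepth (atLeast k) ≤ 6 + D
  atLeast-depth bit≤ zero    = s≤s z≤n
  atLeast-depth bit≤ (suc k) =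
    depth-⋁[] (positions k) _ λ cs →
    depth-⋁[] (patterns k) (block cs) λ V →
    depth-when ⌊ distinct? V ⌋ (depth-⋀[] (allFins (suc k)) (column cs ∘ lookup V) λ j →
    depth-⋁[] (allFins n) (hit cs (lookup V j)) λ i →
    depth-when ⌊ VecP.≡-dec _≟_ (project cs (code i)) (lookup V j) ⌋ (bit≤ i))

-- Translating the sentence into a formula

-- Coefficients and depth bounds are defined outside the module Translation, which depends on the universe
-- size n: the size bound must be f(k)·(n + 1)^c with f independent of n.

module _ {τ : Vocabulary} where

  qfSize : ∀ {v} → QF τ v → ℕ
  qfSize (atom r xs) = 0
  qfSize (equal u w) = 0
  qfSize (inX u)     = 0
  qfSize (neg ψ)     = suc (qfSize ψ)
  qfSize (conj ψ χ)  = suc (qfSize ψ + suc (qfSize χ))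
  qfSize (disj ψ χ)  = suc (qfSize ψ + suc (qfSize χ))

  qfDepth : ∀ {v} → QF τ v → ℕ
  qfDepth (atom r xs) = 0
  qfDepth (equal u w) = 1
  qfDepth (inX u)     = 1
  qfDepth (neg ψ)     = suc (qfDepth ψ)
  qfDepth (conj ψ χ)  = suc (qfDepth ψ ⊔ qfDepth χ)
  qfDepth (disj ψ χ)  = suc (qfDepth ψ ⊔ qfDepth χ)

logFactor : ℕ → ℕ
logFactor k = k ^ k * 2 ^ k * 2

atLeastCoeff : ℕ → ℕ → ℕ
atLeastCoeff = thresholdCoeff 2 logFactor

windowCoeff : Cmp → ℕ → ℕ → ℕ
windowCoeff EQ s k = suc (suc (atLeastCoeff s (suc k)) + suc (atLeastCoeff s k))
windowCoeff LE s k = suc (atLeastCoeff s (suc k))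
windowCoeff GE s k = atLeastCoeff s k

choiceCoeff : Cmp → ℕ → ℕ → ℕ
choiceCoeff ⋈ k s = suc (1 * suc (suc (s + suc s)) + suc (windowCoeff ⋈ (suc s) k))

module _ {τ : Vocabulary} (⋈ : Cmp) (k : ℕ) where

  formulaCoeff : ∀ m {v} → Prenex τ (eᵐa m) v → ℕ
  formulaCoeff zero    {v} (∀' (matrix ψ)) = 2 ^ v * suc (choiceCoeff ⋈ k (qfSize ψ))
  formulaCoeff (suc m)     (∃' φ)          = 1 * suc (formulaCoeff m φ)

formulaDepthBound : ∀ {τ} m {v} → Prenex τ (eᵐa m) v → ℕ
formulaDepthBound zero    (∀' (matrix ψ)) = 12 + qfDepth ψ
formulaDepthBound (suc m) (∃' φ)          = suc (formulaDepthBound m φ)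

module Translation (τ : Vocabulary) (⋈ : Cmp) (k n : ℕ) where

  Input : Set
  Input = InputBits τ n

  open Sizes {Input} n

  -- X is evaluated at the tuple ρ through the guessed bits β.
  translate : ∀ {v} → QF τ v → Vec (Fin n) v → Vec Bool v → Formula Input
  translate (atom r xs) ρ β = var (r , Vec.map (lookup ρ) xs)
  translate (equal u w) ρ β = bool ⌊ lookup ρ u ≟ᶠ lookup ρ w ⌋
  translate (inX u)     ρ β = bool (lookup β u)
  translate (neg ψ)     ρ β = ~ translate ψ ρ β
  translate (conj ψ χ)  ρ β = translate ψ ρ β ∧F translate χ ρ β
  translate (disj ψ χ)  ρ β = translate ψ ρ β ∨F translate χ ρ β

  L : ℕ
  L = proj₁ (binaryLength n)

  n≤2^L : n ≤ 2 ^ L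
  n≤2^L = proj₁ (proj₂ (binaryLength n))

  module AtLeast = Threshold {Input} _≟ᶠ_ (allFins 2) (binaryCode L n≤2^L) (binaryCode-injective L n≤2^L)

  module Matrix {v} (ψ : QF τ (suc v)) (ρ : Vec (Fin n) v) (β : Vec Bool v) where

    Consistent : Fin n → Bool → Set
    Consistent z b = ∀ i → lookup ρ i ≡ z → lookup β i ≡ b

    consistent? : ∀ z b → Dec (Consistent z b)
    consistent? z b = all? λ i → (lookup ρ i ≟ᶠ z) →-dec (lookup β i ≟ᵇ b)

    allowed : Fin n → Bool → Formula Input
    allowed z b = when ⌊ consistent? z b ⌋ (translate ψ (z ∷ ρ) (b ∷ β))

    forced possible : Fin n → Formula Input
    forced   z = ~ allowed z false
    possible z = allowed z true

    window : Cmp → Formula Input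
    window EQ = ~ AtLeast.atLeast forced (suc k) ∧F AtLeast.atLeast possible k
    window LE = ~ AtLeast.atLeast forced (suc k)
    window GE = AtLeast.atLeast possible k

    someAllowed : Fin n → Formula Input
    someAllowed z = allowed z true ∨F allowed z false

    choice : Formula Input
    choice = (⋀[ allFins n ] someAllowed) ∧F window ⋈

  formula : ∀ m {v} → Prenex τ (eᵐa m) v → Vec (Fin n) v → Formula Input
  formula zero    (∀' (matrix ψ)) ρ = ⋁[ allVecs bools _ ] Matrix.choice ψ ρ
  formula (suc m) (∃' φ)          ρ = ⋁[ allFins n ] λ y → formula m φ (y ∷ ρ)

  translate-sized : ∀ {v} (ψ : QF τ v) ρ β → Sized (qfSize ψ) 0 (translate ψ ρ β)
  translate-sized (atom r xs) ρ β = sized-var _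
  translate-sized (equal u w) ρ β = sized-bool _
  translate-sized (inX u)     ρ β = sized-bool _
  translate-sized (neg ψ)     ρ β = sized-~ (translate-sized ψ ρ β)
  translate-sized (conj ψ χ)  ρ β = sized-∧F (translate-sized ψ ρ β) (translate-sized χ ρ β)
  translate-sized (disj ψ χ)  ρ β = sized-∨F (translate-sized ψ ρ β) (translate-sized χ ρ β)

  translate-depth : ∀ {v} (ψ : QF τ v) ρ β → formulaDepth (translate ψ ρ β) ≤ qfDepth ψ
  translate-depth (atom r xs) ρ β = z≤n
  translate-depth (equal u w) ρ β = depth-bool _
  translate-depth (inX u)     ρ β = depth-bool _
  translate-depth (neg ψ)     ρ β = s≤s (translate-depth ψ ρ β)
  translate-depth (conj ψ χ)  ρ β = depth-∧F (≤-trans (translate-depth ψ ρ β) (m≤m⊔n _ _))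
                                             (≤-trans (translate-depth χ ρ β) (m≤n⊔m _ _))
  translate-depth (disj ψ χ)  ρ β = depth-∨F (≤-trans (translate-depth ψ ρ β) (m≤m⊔n _ _))
                                             (≤-trans (translate-depth χ ρ β) (m≤n⊔m _ _))

  L^k≤ : ∀ k → L ^ k ≤ logFactor k * N
  L^k≤ k = begin
    L ^ k                      ≤⟨ polylog≤exp k L ⟩
    k ^ k * 2 ^ k * 2 ^ L      ≤⟨ *-monoʳ-≤ (k ^ k * 2 ^ k) (proj₂ (proj₂ (binaryLength n))) ⟩
    k ^ k * 2 ^ k * (2 * N)    ≡⟨ *-assoc (k ^ k * 2 ^ k) 2 N ⟨
    logFactor k * N            ∎
    where open ≤-Reasoning

  module _ {v} (ψ : QF τ (suc v)) (ρ : Vec (Fin n) v) (β : Vec Bool v) where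
    open Matrix ψ ρ β

    allowed-sized : ∀ z b → Sized (qfSize ψ) 0 (allowed z b)
    allowed-sized z b = sized-when ⌊ consistent? z b ⌋ (translate-sized ψ (z ∷ ρ) (b ∷ β))

    atLeast-forced-sized : ∀ k → Sized (atLeastCoeff (suc (qfSize ψ)) k) 2 (AtLeast.atLeast forced k)
    atLeast-forced-sized =
      AtLeast.atLeast-sized forced logFactor L^k≤ (λ z → sized-~ (allowed-sized z false))

    atLeast-possible-sized : ∀ k → Sized (atLeastCoeff (suc (qfSize ψ)) k) 2 (AtLeast.atLeast possible k)
    atLeast-possible-sized =
      AtLeast.atLeast-sized possible logFactor L^k≤
        (λ z → sized-weaken (n≤1+n _) ≤-refl (allowed-sized z true))

    window-sized : ∀ ⋈′ → Sized (windowCoeff ⋈′ (suc (qfSize ψ)) k) 2 (window ⋈′)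
    window-sized EQ = sized-∧F (sized-~ (atLeast-forced-sized (suc k))) (atLeast-possible-sized k)
    window-sized LE = sized-~ (atLeast-forced-sized (suc k))
    window-sized GE = atLeast-possible-sized k

    choice-sized : Sized (choiceCoeff ⋈ k (qfSize ψ)) 2 choice
    choice-sized = sized-∧F (sized-weaken ≤-refl (n≤1+n 1) everywhere-sized) (window-sized ⋈)
      where
      everywhere-sized : Sized (1 * suc (suc (qfSize ψ + suc (qfSize ψ)))) 1 (⋀[ allFins n ] someAllowed)
      everywhere-sized = sized-⋀[]-linear (allFins n) someAllowed 1 card-allFins≤N
                           λ z → sized-∨F (allowed-sized z true) (allowed-sized z false)

    allowed-depth : ∀ z b → formulaDepth (allowed z b) ≤ suc (qfDepth ψ)
    allowed-depth z b = depth-when ⌊ consistent? z b ⌋ (translate-depth ψ (z ∷ ρ) (b ∷ β))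

    atLeast-forced-depth : ∀ k → formulaDepth (AtLeast.atLeast forced k) ≤ 8 + qfDepth ψ
    atLeast-forced-depth = AtLeast.atLeast-depth
                             forced (λ z → s≤s (allowed-depth z false))

    atLeast-possible-depth : ∀ k → formulaDepth (AtLeast.atLeast possible k) ≤ 8 + qfDepth ψ
    atLeast-possible-depth = AtLeast.atLeast-depth
                               possible (λ z → m≤n⇒m≤1+n (allowed-depth z true))

    window-depth : ∀ ⋈′ → formulaDepth (window ⋈′) ≤ 10 + qfDepth ψ
    window-depth EQ = depth-∧F {s = ~ AtLeast.atLeast forced (suc k)}
                        (s≤s (atLeast-forced-depth (suc k))) (m≤n⇒m≤1+n (atLeast-possible-depth k))
    window-depth LE = m≤n⇒m≤1+n (s≤s (atLeast-forced-depth (suc k)))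
    window-depth GE = m≤n⇒m≤1+n (m≤n⇒m≤1+n (atLeast-possible-depth k))

    choice-depth : formulaDepth choice ≤ 11 + qfDepth ψ
    choice-depth = depth-∧F {s = ⋀[ allFins n ] someAllowed}
                            (≤-trans everywhere-depth (+-monoˡ-≤ (qfDepth ψ) (s≤s (s≤s (s≤s z≤n)))))
                            (window-depth ⋈)
      where
      everywhere-depth : formulaDepth (⋀[ allFins n ] someAllowed) ≤ 3 + qfDepth ψ
      everywhere-depth =
        depth-⋀[] (allFins n) someAllowed λ z → depth-∨F (allowed-depth z true) (allowed-depth z false)

  formula-sized : ∀ m {v} (φ : Prenex τ (eᵐa m) v) ρ →
    Sized (formulaCoeff ⋈ k m φ) (m + 2) (formula m φ ρ)
  formula-sized zero    {v} (∀' (matrix ψ)) ρ =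
    sized-⋁[]-constant (allVecs bools v) (Matrix.choice ψ ρ) (card-allVecs bools v) (choice-sized ψ ρ)
  formula-sized (suc m)     (∃' φ)          ρ =
    sized-⋁[]-linear (allFins n) _ 1 card-allFins≤N
      λ y → formula-sized m φ (y ∷ ρ)

  formula-depth : ∀ m {v} (φ : Prenex τ (eᵐa m) v) ρ →
    formulaDepth (formula m φ ρ) ≤ formulaDepthBound m φ
  formula-depth zero    {v} (∀' (matrix ψ)) ρ =
    depth-⋁[] (allVecs bools v) (Matrix.choice ψ ρ) (choice-depth ψ ρ)
  formula-depth (suc m)     (∃' φ)          ρ =
    depth-⋁[] (allFins n) (λ y → formula m φ (y ∷ ρ)) λ y → formula-depth m φ (y ∷ ρ)

module Correctness {τ : Vocabulary} (⋈ : Cmp) (k : ℕ) (S : Structure τ) where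
  open Translation τ ⋈ k (size S)

  x : Input → Bool
  x = encode S

  Agree : ∀ {v} → Subset (size S) → Vec (Fin (size S)) v → Vec Bool v → Set
  Agree C ρ β = ∀ i → lookup C (lookup ρ i) ≡ lookup β i

  translate-correct : ∀ {v} (ψ : QF τ v) {C ρ β} → Agree C ρ β →
    Holds x (translate ψ ρ β) ⇔ ⟦ ψ ⟧qf S C ρ
  translate-correct (atom r xs) _ = T-≡
  translate-correct (equal u w) {ρ = ρ} _ =
    ⇔.trans (holds-bool x ⌊ lookup ρ u ≟ᶠ lookup ρ w ⌋) (mk⇔ toWitness fromWitness)
  translate-correct (inX u) {C} {ρ} {β} agree = ⇔.trans (holds-bool x (lookup β u)) (mk⇔
    (λ h → VecP.lookup⇒[]= (lookup ρ u) C (trans (agree u) (to T-≡ h)))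
    (λ u∈C → from T-≡ (trans (sym (agree u)) (VecP.[]=⇒lookup u∈C))))
  translate-correct (neg ψ) {ρ = ρ} {β} agree =
    ⇔.trans (holds-~ x (translate ψ ρ β)) (¬-cong-⇔ (translate-correct ψ agree))
  translate-correct (conj ψ χ) {ρ = ρ} {β} agree =
    ⇔.trans (holds-∧F x (translate ψ ρ β) (translate χ ρ β))
            (translate-correct ψ agree ×-⇔ translate-correct χ agree)
  translate-correct (disj ψ χ) {ρ = ρ} {β} agree =
    ⇔.trans (holds-∨F x (translate ψ ρ β) (translate χ ρ β))
            (translate-correct ψ agree ⊎-⇔ translate-correct χ agree)

  module _ {v} (ψ : QF τ (suc v)) (ρ : Vec (Fin (size S)) v) (β : Vec Bool v) where
    open Matrix ψ ρ β

    F P : Subset (size S)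
    F = AtLeast.truths forced x
    P = AtLeast.truths possible x

    ∈F : ∀ {z} → z ∈ F ⇔ (¬ Holds x (allowed z false))
    ∈F {z} = ⇔.trans (AtLeast.∈-truths forced x) (holds-~ x (allowed z false))

    ∈P : ∀ {z} → z ∈ P ⇔ Holds x (allowed z true)
    ∈P = AtLeast.∈-truths possible x

    holds-allowed : ∀ z b →
      Holds x (allowed z b) ⇔ (Consistent z b × Holds x (translate ψ (z ∷ ρ) (b ∷ β)))
    holds-allowed z b = mk⇔ (λ h → let c , t = to unfold h in toWitness c , t)
                            (λ (c , t) → from unfold (fromWitness c , t))
      where
      unfold : Holds x (allowed z b) ⇔ (T ⌊ consistent? z b ⌋ × Holds x (translate ψ (z ∷ ρ) (b ∷ β)))
      unfold = holds-when x ⌊ consistent? z b ⌋ (translate ψ (z ∷ ρ) (b ∷ β))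

    someAllowed-everywhere⇔F⊆P : (∀ z → Holds x (someAllowed z)) ⇔ F ⊆ P
    someAllowed-everywhere⇔F⊆P = mk⇔
      (λ h {z} z∈F → from ∈P ([ (λ t → t) , (λ f → contradiction f (to ∈F z∈F)) ]′
                                (to (either z) (h z))))
      (λ F⊆P z → from (either z) (case-allowed F⊆P z (T? (eval x (allowed z false)))))
      where
      either : ∀ z → Holds x (someAllowed z) ⇔ (Holds x (allowed z true) ⊎ Holds x (allowed z false))
      either z = holds-∨F x (allowed z true) (allowed z false)
      case-allowed : F ⊆ P → ∀ z → Dec (Holds x (allowed z false)) →
        Holds x (allowed z true) ⊎ Holds x (allowed z false)
      case-allowed F⊆P z (yes f) = inj₂ f
      case-allowed F⊆P z (no ¬f) = inj₁ (to ∈P (F⊆P (from ∈F ¬f)))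

    allowed-everywhere⇔between : ∀ {C} → (∀ z → Holds x (allowed z (lookup C z))) ⇔ (F ⊆ C × C ⊆ P)
    allowed-everywhere⇔between {C} = mk⇔ between (λ (F⊆C , C⊆P) → allowed-at F⊆C C⊆P)
      where
      F⊆C : (∀ z → Holds x (allowed z (lookup C z))) → F ⊆ C
      F⊆C h {z} z∈F with lookup C z in eq | h z
      ... | true  | _  = VecP.lookup⇒[]= z C eq
      ... | false | hz = contradiction hz (to ∈F z∈F)
      C⊆P : (∀ z → Holds x (allowed z (lookup C z))) → C ⊆ P
      C⊆P h {z} z∈C = from ∈P (subst (Holds x ∘ allowed z) (VecP.[]=⇒lookup z∈C) (h z))
      between : (∀ z → Holds x (allowed z (lookup C z))) → F ⊆ C × C ⊆ P
      between h = F⊆C h , C⊆P h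
      allowed-at : F ⊆ C → C ⊆ P → ∀ z → Holds x (allowed z (lookup C z))
      allowed-at F⊆C C⊆P z with lookup C z in eq
      ... | true = to ∈P (C⊆P (VecP.lookup⇒[]= z C eq))
      ... | false with T? (eval x (allowed z false))
      ...   | yes f  = f
      ...   | no  ¬f = contradiction (trans (sym (VecP.[]=⇒lookup (F⊆C (from ∈F ¬f)))) eq) λ ()

    allowed-everywhere⇔satisfies : ∀ {C} →
      (∀ z → Holds x (allowed z (lookup C z))) ⇔ (Agree C ρ β × ∀ z → ⟦ ψ ⟧qf S C (z ∷ ρ))
    allowed-everywhere⇔satisfies {C} = mk⇔
      (λ h → let agree = λ i → sym (proj₁ (to (holds-allowed _ _) (h (lookup ρ i))) i refl)
             in agree ,
                λ z → to (translate-correct ψ (agree-∷ agree z)) (proj₂ (to (holds-allowed _ _) (h z))))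
      (λ (agree , sat) z → from (holds-allowed z _)
         ((λ i ρi≡z → trans (sym (agree i)) (cong (lookup C) ρi≡z)) ,
          from (translate-correct ψ (agree-∷ agree z)) (sat z)))
      where
      agree-∷ : Agree C ρ β → ∀ z → Agree C (z ∷ ρ) (lookup C z ∷ β)
      agree-∷ agree z zero    = refl
      agree-∷ agree z (suc i) = agree i

    few-forced : Holds x (~ AtLeast.atLeast forced (suc k)) ⇔ ∣ F ∣ ≤ k
    few-forced = ⇔.trans (holds-~ x (AtLeast.atLeast forced (suc k)))
                   (⇔.trans (¬-cong-⇔ (AtLeast.atLeast-correct forced x (suc k))) (mk⇔ ≮⇒≥ ≤⇒≯))

    window-correct : ∀ ⋈′ → Holds x (window ⋈′) ⇔ Window ⋈′ ∣ F ∣ ∣ P ∣ k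
    window-correct EQ = ⇔.trans (holds-∧F x (~ AtLeast.atLeast forced (suc k)) (AtLeast.atLeast possible k))
                                (few-forced ×-⇔ AtLeast.atLeast-correct possible x k)
    window-correct LE = few-forced
    window-correct GE = AtLeast.atLeast-correct possible x k

    choice-correct : Holds x choice ⇔ ∃ λ C → (F ⊆ C × C ⊆ P) × cmp ⋈ ∣ C ∣ k
    choice-correct =
      ⇔.trans (holds-∧F x (⋀[ allFins (size S) ] someAllowed) (window ⋈))
        (⇔.trans (⇔.trans (holds-⋀[] x someAllowed (allFins (size S))) someAllowed-everywhere⇔F⊆P
                    ×-⇔ window-correct ⋈)
                 (⊆-interpolate-cmp ⋈))

    choice⇔witness :
      Holds x choice ⇔ ∃ λ C → cmp ⋈ ∣ C ∣ k × Agree C ρ β × (∀ z → ⟦ ψ ⟧qf S C (z ∷ ρ))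
    choice⇔witness = ⇔.trans choice-correct (mk⇔
      (λ (C , between , C⋈k) →
         C , C⋈k , to allowed-everywhere⇔satisfies (from allowed-everywhere⇔between between))
      (λ (C , C⋈k , witness) →
         C , to allowed-everywhere⇔between (from allowed-everywhere⇔satisfies witness) , C⋈k))

  Satisfiable : ∀ {p v} → Prenex τ p v → Vec (Fin (size S)) v → Set
  Satisfiable φ ρ = Σ (Subset (size S)) λ C → cmp ⋈ ∣ C ∣ k × ⟦ φ ⟧pr S C ρ

  matrix-correct : ∀ {v} (ψ : QF τ (suc v)) ρ →
    Holds x (formula 0 (∀' (matrix ψ)) ρ) ⇔ Satisfiable (∀' (matrix ψ)) ρ
  matrix-correct {v} ψ ρ = ⇔.trans (holds-⋁[] x (Matrix.choice ψ ρ) (allVecs bools v)) (mk⇔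
    (λ (β , h) → let C , C⋈k , _ , sat = to (choice⇔witness ψ ρ β) h in C , C⋈k , sat)
    (λ (C , C⋈k , sat) → Vec.map (lookup C) ρ ,
       from (choice⇔witness ψ ρ _) (C , C⋈k , (λ i → sym (VecP.lookup-map i (lookup C) ρ)) , sat)))

  formula-correct : ∀ m {v} (φ : Prenex τ (eᵐa m) v) ρ → Holds x (formula m φ ρ) ⇔ Satisfiable φ ρ
  formula-correct zero    (∀' (matrix ψ)) ρ = matrix-correct ψ ρ
  formula-correct (suc m) (∃' φ)          ρ =
    ⇔.trans (holds-⋁[] x (λ y → formula m φ (y ∷ ρ)) (allFins (size S))) (mk⇔
      (λ (y , h) → let C , C⋈k , sat = to (formula-correct m φ (y ∷ ρ)) h in C , C⋈k , y , sat)
      (λ (C , C⋈k , y , sat) → y , from (formula-correct m φ (y ∷ ρ)) (C , C⋈k , sat)))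

mainTheorem8 : (m : ℕ) (⋈ : Cmp) (τ : Vocabulary) (Q : ParProblem τ)
    → InPFD ⋈ (eᵐa m) τ Q → InParaAC0 τ Q
mainTheorem8 m ⋈ τ Q (φ , Q⇔⊨) = coeff , m + 2 , formulaDepthBound m φ , family , bounds , decides
  where
  open Compilation
  open CircuitFor

  compiled : ∀ n k → CircuitFor (Translation.formula τ ⋈ k n m φ [])
  compiled n k = formulaCircuit _

  coeff : ℕ → ℕ
  coeff k = suc (formulaCoeff ⋈ k m φ)

  family : (n k : ℕ) → Σ ℕ λ s → Circuit (InputBits τ n) (suc s)
  family n k = gates (compiled n k) , circuit (compiled n k)

  bounds : (n k : ℕ) → suc (gates (compiled n k)) ≤ coeff k * suc n ^ (m + 2)
                     × depth (circuit (compiled n k)) ≤ formulaDepthBound m φ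
  bounds n k =
    ≤-trans (≤-reflexive (gates≡size (compiled n k))) (Sizes.size≤ (Translation.formula-sized τ ⋈ k n m φ [])) ,
    ≤-trans (depth≤ (compiled n k)) (Translation.formula-depth τ ⋈ k n m φ [])

  decides : (S : Structure τ) (k : ℕ) → Q S k ⇔ (output (circuit (compiled (size S) k)) (encode S) ≡ true)
  decides S k = ⇔.trans (Q⇔⊨ S k) (⇔.trans (⇔.sym (Correctness.formula-correct ⋈ k S m φ []))
                                           (⇔.sym (output≡true⇔holds (compiled (size S) k) (encode S))))
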